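{- Let $p\ge 5$ be a prime and $\kappa\in\{2,\dots,p-2\}$. A $\Phi_\kappa$-sequence $(a_n)_{n\in\mathbb{Z}}$ in $\mathbb{F}_p$ is complete if and only if $(a_{p-1-n})_{n\in\mathbb{Z}}$ is a complete $\Phi_{p-\kappa}$-sequence.
   Context: For a prime $p\ge 5$ and $\kappa\in\{2,\dots,p-2\}$, a sequence $(a_n)_{n\in\mathbb{Z}}$ of elements of $\mathbb{F}_p$ is a $\Phi_\kappa$-sequence if $a_0=1$ and $a_{n+\kappa}=a_n+a_{n+1}$ in $\mathbb{F}_p$ for all $n\in\mathbb{Z}$. It is complete if it is periodic with period $p-1$ and $\{a_1,\dots,a_{p-2}\}=\{2,\dots,p-1\}$. -}

module Defs where

open import Data.Nat using (ℕ; _+_; _∸_; _≤_; NonZero)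
open import Data.Nat.DivMod using (_mod_)
open import Data.Fin using (Fin; toℕ)
open import Data.Integer as ℤ using (ℤ; +_)
open import Data.Product using (_×_; ∃)
open import Relation.Binary.PropositionalEquality using (_≡_)

𝔽 : ℕ → Set
𝔽 p = Fin p

infixl 6 _⊕_
_⊕_ : ∀ {p} .{{_ : NonZero p}} → 𝔽 p → 𝔽 p → 𝔽 p
_⊕_ {p} x y = (toℕ x + toℕ y) mod p

one : ∀ p .{{_ : NonZero p}} → 𝔽 p
one p = 1 mod p

IsΦSeq : ∀ p .{{_ : NonZero p}} → ℕ → (ℤ → 𝔽 p) → Set
IsΦSeq p κ a = (a (+ 0) ≡ one p) × (∀ (n : ℤ) → a (n ℤ.+ + κ) ≡ a n ⊕ a (n ℤ.+ + 1))

IsComplete : ∀ p .{{_ : NonZero p}} → (ℤ → 𝔽 p) → Set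
IsComplete p a =
  (∀ (n : ℤ) → a (n ℤ.+ + (p ∸ 1)) ≡ a n)
  × (∀ (i : ℕ) → 1 ≤ i → i ≤ p ∸ 2 → 2 ≤ toℕ (a (+ i)))
  × (∀ (x : 𝔽 p) → 2 ≤ toℕ x → ∃ λ (i : ℕ) → 1 ≤ i × i ≤ p ∸ 2 × a (+ i) ≡ x)

reverseSeq : ∀ p → (ℤ → 𝔽 p) → (ℤ → 𝔽 p)
reverseSeq p a n = a (+ (p ∸ 1) ℤ.- n)

{-# OPTIONS --safe #-}
-- Reversal n ↦ p − 1 − n is an involution that maps the window {1, …, p − 2}
-- onto itself and preserves (p − 1)-periodicity, so it preserves completeness.
-- For a (p − 1)-periodic sequence the reversal is b n = a (− n), and the
-- Φ_κ-recurrence of a at m = − n − 1 becomes b (n + (p − κ)) = b n + b (n + 1),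
-- because − n − 1 + κ ≡ − n − (p − κ) modulo p − 1.
module Submission where

open import Defs
open import Data.Nat as ℕ using (ℕ; suc; _≤_; _∸_; NonZero; s≤s; z≤n)
import Data.Nat.Properties as ℕ
open import Data.Nat.DivMod using (_mod_)
open import Data.Nat.Primality using (Prime)
open import Data.Fin using (toℕ)
open import Data.Integer as ℤ using (ℤ; +_; -_)
import Data.Integer.Properties as ℤ
open import Data.Integer.Tactic.RingSolver using (solve-∀)
open import Data.Product using (_×_; _,_; ∃)
open import Function.Bundles using (_⇔_; mk⇔)
open import Relation.Binary.PropositionalEquality
open ≡-Reasoning

pos-∸ : ∀ {m n} → n ≤ m → + (m ∸ n) ≡ + m ℤ.- + n
pos-∸ {m} {n} n≤m = sym (trans (ℤ.m-n≡m⊖n m n) (ℤ.⊖-≥ n≤m))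

⊕-comm : ∀ {p} .{{_ : NonZero p}} (x y : 𝔽 p) → x ⊕ y ≡ y ⊕ x
⊕-comm {p} x y = cong (_mod p) (ℕ.+-comm (toℕ x) (toℕ y))

Periodic : {A : Set} → ℕ → (ℤ → A) → Set
Periodic N a = ∀ n → a (n ℤ.+ + N) ≡ a n

∸-reflects-window : ∀ {p i} → 1 ≤ i → i ≤ p ∸ 2 → 1 ≤ p ∸ 1 ∸ i × p ∸ 1 ∸ i ≤ p ∸ 2
∸-reflects-window {suc (suc q)} {suc i} _ i<q = ℕ.m<n⇒0<n∸m (s≤s i<q) , ℕ.m∸n≤m q i

window⇒≤p∸1 : ∀ {p i} → i ≤ p ∸ 2 → i ≤ p ∸ 1
window⇒≤p∸1 {p} i≤p∸2 = ℕ.≤-trans i≤p∸2 (ℕ.∸-monoʳ-≤ p (s≤s z≤n))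

IsComplete-resp : ∀ {p} .{{_ : NonZero p}} {a b : ℤ → 𝔽 p} →
                  (∀ n → a n ≡ b n) → IsComplete p a → IsComplete p b
IsComplete-resp a≗b (periodic , inWindow , onto) =
    (λ n → trans (sym (a≗b _)) (trans (periodic n) (a≗b n)))
  , (λ i 1≤i i≤ → subst (λ x → 2 ≤ toℕ x) (a≗b _) (inWindow i 1≤i i≤))
  , (λ x 2≤x → let i , 1≤i , i≤ , aᵢ≡x = onto x 2≤x in
               i , 1≤i , i≤ , trans (sym (a≗b _)) aᵢ≡x)

module _ {p : ℕ} (a : ℤ → 𝔽 p) where

  reverseSeq-involutive : ∀ n → reverseSeq p (reverseSeq p a) n ≡ a n
  reverseSeq-involutive n = cong a (reflect-twice (+ (p ∸ 1)) n)
    where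
    reflect-twice : ∀ (P n : ℤ) → P ℤ.- (P ℤ.- n) ≡ n
    reflect-twice = solve-∀

  reverseSeq-at : ∀ {i} → i ≤ p ∸ 1 → reverseSeq p a (+ i) ≡ a (+ (p ∸ 1 ∸ i))
  reverseSeq-at i≤ = cong a (sym (pos-∸ i≤))

  reverseSeq-of-periodic : Periodic (p ∸ 1) a → ∀ n → reverseSeq p a n ≡ a (- n)
  reverseSeq-of-periodic periodic n =
    trans (cong a (ℤ.+-comm (+ (p ∸ 1)) (- n))) (periodic (- n))

  reverseSeq-periodic : Periodic (p ∸ 1) a → Periodic (p ∸ 1) (reverseSeq p a)
  reverseSeq-periodic periodic n = begin
    a (P ℤ.- (n ℤ.+ P))  ≡⟨ cong a (reflect-shift P n) ⟩
    a (- n)              ≡⟨ reverseSeq-of-periodic periodic n ⟨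
    a (P ℤ.- n)          ∎
    where
    P = + (p ∸ 1)
    reflect-shift : ∀ (P n : ℤ) → P ℤ.- (n ℤ.+ P) ≡ - n
    reflect-shift = solve-∀

  reverseSeq-isComplete : .{{_ : NonZero p}} → IsComplete p a → IsComplete p (reverseSeq p a)
  reverseSeq-isComplete (periodic , inWindow , onto) =
    reverseSeq-periodic periodic , inWindow′ , onto′
    where
    inWindow′ : ∀ i → 1 ≤ i → i ≤ p ∸ 2 → 2 ≤ toℕ (reverseSeq p a (+ i))
    inWindow′ i 1≤i i≤ with 1≤j , j≤ ← ∸-reflects-window {p} 1≤i i≤ =
      subst (λ x → 2 ≤ toℕ x) (sym (reverseSeq-at (window⇒≤p∸1 {p} i≤)))
            (inWindow (p ∸ 1 ∸ i) 1≤j j≤)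

    onto′ : ∀ x → 2 ≤ toℕ x →
            ∃ λ j → 1 ≤ j × j ≤ p ∸ 2 × reverseSeq p a (+ j) ≡ x
    onto′ x 2≤x with i , 1≤i , i≤ , aᵢ≡x ← onto x 2≤x
                  with 1≤j , j≤ ← ∸-reflects-window {p} 1≤i i≤ =
      p ∸ 1 ∸ i , 1≤j , j≤ , (begin
        reverseSeq p a (+ (p ∸ 1 ∸ i))  ≡⟨ reverseSeq-at (window⇒≤p∸1 {p} j≤) ⟩
        a (+ (p ∸ 1 ∸ (p ∸ 1 ∸ i)))     ≡⟨ cong (λ k → a (+ k)) (ℕ.m∸[m∸n]≡n (window⇒≤p∸1 {p} i≤)) ⟩
        a (+ i)                         ≡⟨ aᵢ≡x ⟩
        x                               ∎)

  reverseSeq-isΦSeq : .{{_ : NonZero p}} → ∀ {κ} → κ ≤ p → Periodic (p ∸ 1) a →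
                      IsΦSeq p κ a → IsΦSeq p (p ∸ κ) (reverseSeq p a)
  reverseSeq-isΦSeq {κ} κ≤p periodic (a₀≡1 , recurrence) =
    trans (reverseSeq-of-periodic periodic (+ 0)) a₀≡1 , recurrence′
    where
    b = reverseSeq p a

    reflect-index : ∀ n → + (p ∸ 1) ℤ.- (n ℤ.+ + (p ∸ κ)) ≡ - (n ℤ.+ + 1) ℤ.+ + κ
    reflect-index n = begin
      + (p ∸ 1) ℤ.- (n ℤ.+ + (p ∸ κ))
        ≡⟨ cong₂ (λ P Q → P ℤ.- (n ℤ.+ Q)) (pos-∸ (ℕ.>-nonZero⁻¹ p)) (pos-∸ κ≤p) ⟩
      (+ p ℤ.- + 1) ℤ.- (n ℤ.+ (+ p ℤ.- + κ))
        ≡⟨ identity (+ p) (+ κ) n ⟩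
      - (n ℤ.+ + 1) ℤ.+ + κ ∎
      where
      identity : ∀ (p κ n : ℤ) → (p ℤ.- + 1) ℤ.- (n ℤ.+ (p ℤ.- κ)) ≡ - (n ℤ.+ + 1) ℤ.+ κ
      identity = solve-∀

    step-back : ∀ (n : ℤ) → - (n ℤ.+ + 1) ℤ.+ + 1 ≡ - n
    step-back = solve-∀

    recurrence′ : ∀ n → b (n ℤ.+ + (p ∸ κ)) ≡ b n ⊕ b (n ℤ.+ + 1)
    recurrence′ n = begin
      b (n ℤ.+ + (p ∸ κ))                      ≡⟨ cong a (reflect-index n) ⟩
      a (m ℤ.+ + κ)                            ≡⟨ recurrence m ⟩
      a m ⊕ a (m ℤ.+ + 1)                      ≡⟨ ⊕-comm (a m) _ ⟩
      a (m ℤ.+ + 1) ⊕ a m                      ≡⟨ cong (λ k → a k ⊕ a m) (step-back n) ⟩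
      a (- n) ⊕ a m                            ≡⟨ cong₂ _⊕_ (reverseSeq-of-periodic periodic n)
                                                            (reverseSeq-of-periodic periodic (n ℤ.+ + 1)) ⟨
      b n ⊕ b (n ℤ.+ + 1)                      ∎
      where m = - (n ℤ.+ + 1)

proposition5p6 : (p : ℕ) .{{_ : NonZero p}} → Prime p → 5 ≤ p →
                 (κ : ℕ) → 2 ≤ κ → κ ≤ p ∸ 2 →
                 (a : ℤ → 𝔽 p) → IsΦSeq p κ a →
                 (IsComplete p a ⇔ (IsΦSeq p (p ∸ κ) (reverseSeq p a) × IsComplete p (reverseSeq p a)))
proposition5p6 p _ _ κ _ κ≤p∸2 a φ = mk⇔
  (λ complete@(periodic , _) →
     reverseSeq-isΦSeq a κ≤p periodic φ , reverseSeq-isComplete a complete)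
  (λ (_ , reverseComplete) →
     IsComplete-resp (reverseSeq-involutive a) (reverseSeq-isComplete (reverseSeq p a) reverseComplete))
  where
  κ≤p : κ ≤ p
  κ≤p = ℕ.≤-trans κ≤p∸2 (ℕ.m∸n≤m p 2)
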